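{- For all terms $M,N$: if $M\to_{\ell\cup\beta}N$, then for every base term $K$, $M:K\to^{*}_{a\cup\beta}N:K$.
   Context: Fix a ring of scalars (elements $\alpha,\beta$). Terms: $M,N,L ::= V \mid (M)~N \mid \alpha.M \mid M+N$; values $V,W ::= 0 \mid B \mid \alpha.V \mid V+W$; base terms $B ::= x \mid \lambda x\,M$. $M[x:=N]$ is capture-avoiding substitution. Rewrite rules: $(\beta_n)$ $(\lambda x\,M)~N\to M[x:=N]$. $(A)$ $(M+N)~L\to (M)~L+(N)~L$; $(\alpha.M)~N\to\alpha.(M)~N$; $(0)~M\to 0$. $(\beta_v)$ $(\lambda x\,M)~B\to M[x:=B]$ ($B$ base). $(A_l)$ $(M+N)~V\to(M)~V+(N)~V$; $(\alpha.M)~V\to\alpha.(M)~V$; $(0)~V\to 0$ ($V$ value). $(A_r)$ $(B)~(M+N)\to(B)~M+(B)~N$; $(B)~(\alpha.M)\to\alpha.(B)~M$; $(B)~0\to 0$ ($B$ base). (Asso) $M+(N+L)\to(M+N)+L$ and $(M+N)+L\to M+(N+L)$. (Com) $M+N\to N+M$. $(F)$ $\alpha.M+\beta.M\to(\alpha+\beta).M$; $\alpha.M+M\to(\alpha+1).M$; $M+M\to(1+1).M$; $\alpha.(\beta.M)\to(\alpha\beta).M$. $(S)$ $\alpha.(M+N)\to\alpha.M+\alpha.N$; $1.M\to M$; $0.M\to 0$; $\alpha.0\to 0$; $0+M\to M$. Context rules $(\xi)$: from $M\to M'$ infer $(M)~N\to(M')~N$, $M+N\to M'+N$, $N+M\to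 N+M'$, $\alpha.M\to\alpha.M'$; $(\xi_{lin})$: from $M\to M'$ infer $(V)~M\to(V)~M'$ for $V$ a value. Let $L=\mathrm{Asso}\cup\mathrm{Com}\cup F\cup S$. $\to_a$: generated by $A\cup L$ closed under $\xi$; $\to_\ell$: by $A_l\cup A_r\cup L$ closed under $\xi,\xi_{lin}$; $\to_{\beta_v}$: by $\beta_v$ closed under $\xi,\xi_{lin}$; $\to_{\beta_n}$: by $\beta_n$ closed under $\xi$. $\to_{\ell\cup\beta}:=\to_\ell\cup\to_{\beta_v}$, $\to_{a\cup\beta}:=\to_a\cup\to_{\beta_n}$; $R^{*}$ is reflexive-transitive closure. Translation (with $f,g,h$ fresh): $\widetilde{x}=\lambda f\,(f)~x$; $\widetilde{0}=0$; $\widetilde{\lambda x\,M}=\lambda f\,(f)~\lambda x\,\widetilde{M}$; $\widetilde{(M)~N}=\lambda f\,(\widetilde M)~\lambda g\,(\widetilde N)~\lambda h\,((g)~h)~f$; $\widetilde{\alpha.M}=\lambda f\,(\alpha.\widetilde M)~f$; $\widetilde{M+N}=\lambda f\,(\widetilde M+\widetilde N)~f$; $\Psi(x)=x$, $\Psi(0)=0$, $\Psi(\lambda x\,M)=\lambda x\,\widetilde M$, $\Psi(\alpha.V)=\alpha.\Psi(V)$, $\Psi(V+W)=\Psi(V)+\Psi(W)$. The binary operation $M:K$ (with $B$ a base term) is defined by: $0:K=0$; $B:K=(K)~\Psi(B)$; $\alpha.M:K=\alpha.(M:K)$; $M+N:K=(M:K)+(N:K)$; $(0)~N:K=0$; $(B)~N:K=N:\lambda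 f\,((\Psi(B))~f)~K$; $(\alpha.M)~N:K=(\alpha.((M)~N)):K$; $(M+N)~L:K=((M)~L+(N)~L):K$; $((M)~N)~L:K=(M)~N:\lambda g\,(\widetilde L)~\lambda h\,((g)~h)~K$. -}

module Defs where

open import Level using (_⊔_)
open import Data.Nat using (ℕ; zero; suc)
open import Data.Fin using (Fin) renaming (zero to fz; suc to fs)
open import Data.Sum using (_⊎_)
open import Algebra.Bundles using (Ring)
open import Relation.Binary.Construct.Closure.ReflexiveTransitive using (Star)

module Lang {c ℓ} (R : Ring c ℓ) where
  open Ring R using (Carrier; 0#; 1#) renaming (_+_ to _+ᴿ_; _*_ to _*ᴿ_)

  -- Terms in de Bruijn notation: Term n has free variables among Fin n.
  -- var = x, lam = λ, zer = 0, app = (M) N, scal α M = α.M, plus M N = M + N.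
  data Term (n : ℕ) : Set c where
    var  : Fin n → Term n
    lam  : Term (suc n) → Term n
    zer  : Term n
    app  : Term n → Term n → Term n
    scal : Carrier → Term n → Term n
    plus : Term n → Term n → Term n

  data Base {n : ℕ} : Term n → Set c where
    var : (x : Fin n) → Base (var x)
    lam : (M : Term (suc n)) → Base (lam M)

  data Value {n : ℕ} : Term n → Set c where
    zer  : Value zer
    base : {B : Term n} → Base B → Value B
    scal : {V : Term n} (α : Carrier) → Value V → Value (scal α V)
    plus : {V W : Term n} → Value V → Value W → Value (plus V W)

  ext : {n m : ℕ} → (Fin n → Fin m) → Fin (suc n) → Fin (suc m)
  ext ρ fz     = fz
  ext ρ (fs x) = fs (ρ x)

  rename : {n m : ℕ} → (Fin n → Fin m) → Term n → Term m
  rename ρ (var x)    = var (ρ x)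
  rename ρ (lam M)    = lam (rename (ext ρ) M)
  rename ρ zer        = zer
  rename ρ (app M N)  = app (rename ρ M) (rename ρ N)
  rename ρ (scal α M) = scal α (rename ρ M)
  rename ρ (plus M N) = plus (rename ρ M) (rename ρ N)

  wk : {n : ℕ} → Term n → Term (suc n)
  wk = rename fs

  exts : {n m : ℕ} → (Fin n → Term m) → Fin (suc n) → Term (suc m)
  exts σ fz     = var fz
  exts σ (fs x) = wk (σ x)

  subst : {n m : ℕ} → (Fin n → Term m) → Term n → Term m
  subst σ (var x)    = σ x
  subst σ (lam M)    = lam (subst (exts σ) M)
  subst σ zer        = zer
  subst σ (app M N)  = app (subst σ M) (subst σ N)
  subst σ (scal α M) = scal α (subst σ M)
  subst σ (plus M N) = plus (subst σ M) (subst σ N)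

  -- M[x:=N] where x is the variable bound by the enclosing λ
  _[_] : {n : ℕ} → Term (suc n) → Term n → Term n
  _[_] {n} M N = subst σ M
    where
    σ : Fin (suc n) → Term n
    σ fz     = N
    σ (fs x) = var x

  Rel : Set (Level.suc c)
  Rel = {n : ℕ} → Term n → Term n → Set c

  data Asso : Rel where
    asso₁ : ∀ {n} (M N L : Term n) → Asso (plus M (plus N L)) (plus (plus M N) L)
    asso₂ : ∀ {n} (M N L : Term n) → Asso (plus (plus M N) L) (plus M (plus N L))

  data Com : Rel where
    com : ∀ {n} (M N : Term n) → Com (plus M N) (plus N M)

  data F : Rel where
    f₁ : ∀ {n} α β (M : Term n) → F (plus (scal α M) (scal β M)) (scal (α +ᴿ β) M)
    f₂ : ∀ {n} α (M : Term n) → F (plus (scal α M) M) (scal (α +ᴿ 1#) M)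
    f₃ : ∀ {n} (M : Term n) → F (plus M M) (scal (1# +ᴿ 1#) M)
    f₄ : ∀ {n} α β (M : Term n) → F (scal α (scal β M)) (scal (α *ᴿ β) M)

  data S : Rel where
    s₁ : ∀ {n} α (M N : Term n) → S (scal α (plus M N)) (plus (scal α M) (scal α N))
    s₂ : ∀ {n} (M : Term n) → S (scal 1# M) M
    s₃ : ∀ {n} (M : Term n) → S (scal 0# M) zer
    s₄ : ∀ {n} α → S {n} (scal α zer) zer
    s₅ : ∀ {n} (M : Term n) → S (plus zer M) M

  data LR : Rel where
    asso : ∀ {n} {M N : Term n} → Asso M N → LR M N
    com  : ∀ {n} {M N : Term n} → Com M N → LR M N
    f    : ∀ {n} {M N : Term n} → F M N → LR M N
    s    : ∀ {n} {M N : Term n} → S M N → LR M N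

  data A : Rel where
    a₁ : ∀ {n} (M N L : Term n) → A (app (plus M N) L) (plus (app M L) (app N L))
    a₂ : ∀ {n} α (M N : Term n) → A (app (scal α M) N) (scal α (app M N))
    a₃ : ∀ {n} (M : Term n) → A (app zer M) zer

  data Al : Rel where
    al₁ : ∀ {n} (M N V : Term n) → Value V → Al (app (plus M N) V) (plus (app M V) (app N V))
    al₂ : ∀ {n} α (M V : Term n) → Value V → Al (app (scal α M) V) (scal α (app M V))
    al₃ : ∀ {n} (V : Term n) → Value V → Al (app zer V) zer

  data Ar : Rel where
    ar₁ : ∀ {n} (B M N : Term n) → Base B → Ar (app B (plus M N)) (plus (app B M) (app B N))
    ar₂ : ∀ {n} α (B M : Term n) → Base B → Ar (app B (scal α M)) (scal α (app B M))
    ar₃ : ∀ {n} (B : Term n) → Base B → Ar (app B zer) zer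

  data βn : Rel where
    beta : ∀ {n} (M : Term (suc n)) (N : Term n) → βn (app (lam M) N) (M [ N ])

  data βv : Rel where
    beta : ∀ {n} (M : Term (suc n)) (B : Term n) → Base B → βv (app (lam M) B) (M [ B ])

  _∪_ : Rel → Rel → Rel
  (P ∪ Q) M N = P M N ⊎ Q M N

  data Ξ (P : Rel) : Rel where
    base  : ∀ {n} {M M' : Term n} → P M M' → Ξ P M M'
    appL  : ∀ {n} {M M' : Term n} (N : Term n) → Ξ P M M' → Ξ P (app M N) (app M' N)
    plusL : ∀ {n} {M M' : Term n} (N : Term n) → Ξ P M M' → Ξ P (plus M N) (plus M' N)
    plusR : ∀ {n} {M M' : Term n} (N : Term n) → Ξ P M M' → Ξ P (plus N M) (plus N M')
    scal  : ∀ {n} {M M' : Term n} α → Ξ P M M' → Ξ P (scal α M) (scal α M')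

  data Ξlin (P : Rel) : Rel where
    base  : ∀ {n} {M M' : Term n} → P M M' → Ξlin P M M'
    appL  : ∀ {n} {M M' : Term n} (N : Term n) → Ξlin P M M' → Ξlin P (app M N) (app M' N)
    plusL : ∀ {n} {M M' : Term n} (N : Term n) → Ξlin P M M' → Ξlin P (plus M N) (plus M' N)
    plusR : ∀ {n} {M M' : Term n} (N : Term n) → Ξlin P M M' → Ξlin P (plus N M) (plus N M')
    scal  : ∀ {n} {M M' : Term n} α → Ξlin P M M' → Ξlin P (scal α M) (scal α M')
    appR  : ∀ {n} {M M' : Term n} (V : Term n) → Value V → Ξlin P M M' → Ξlin P (app V M) (app V M')

  _→a_ _→ℓ_ _→βv_ _→βn_ _→ℓ∪β_ _→a∪β_ : Rel
  _→a_   = Ξ (A ∪ LR)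
  _→ℓ_   = Ξlin ((Al ∪ Ar) ∪ LR)
  _→βv_  = Ξlin βv
  _→βn_  = Ξ βn
  _→ℓ∪β_ = _→ℓ_ ∪ _→βv_
  _→a∪β_ = _→a_ ∪ _→βn_

  _→a∪β*_ : {n : ℕ} → Term n → Term n → Set c
  _→a∪β*_ = Star _→a∪β_

  -- CPS translation  M ↦ M̃  (f, g, h fresh = newly bound de Bruijn indices)
  tilde : {n : ℕ} → Term n → Term n
  tilde (var x)    = lam (app (var fz) (var (fs x)))
  tilde zer        = zer
  tilde (lam M)    = lam (app (var fz) (wk (lam (tilde M))))
  tilde (app M N)  = lam (app (wk (tilde M))
                       (lam (app (wk (wk (tilde N)))
                         (lam (app (app (var (fs fz)) (var fz)) (var (fs (fs fz))))))))
  tilde (scal α M) = lam (app (scal α (wk (tilde M))) (var fz))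
  tilde (plus M N) = lam (app (plus (wk (tilde M)) (wk (tilde N))) (var fz))

  Ψ : {n : ℕ} (V : Term n) → Value V → Term n
  Ψ .zer zer = zer
  Ψ .(var x) (base (var x)) = var x
  Ψ .(lam M) (base (lam M)) = lam (tilde M)
  Ψ .(scal α _) (scal α v) = scal α (Ψ _ v)
  Ψ .(plus _ _) (plus v w) = plus (Ψ _ v) (Ψ _ w)

  -- the colon operation M : K.  colonApp M N K stands for ((M) N) : K.
  colon : {n : ℕ} → Term n → Term n → Term n
  colonApp : {n : ℕ} → Term n → Term n → Term n → Term n

  colon zer K        = zer
  colon (var x) K    = app K (Ψ (var x) (base (var x)))
  colon (lam M) K    = app K (Ψ (lam M) (base (lam M)))
  colon (scal α M) K = scal α (colon M K)
  colon (plus M N) K = plus (colon M K) (colon N K)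
  colon (app M N) K  = colonApp M N K

  colonApp zer N K        = zer
  colonApp (var x) N K    =
    colon N (lam (app (app (wk (Ψ (var x) (base (var x)))) (var fz)) (wk K)))
  colonApp (lam M) N K    =
    colon N (lam (app (app (wk (Ψ (lam M) (base (lam M)))) (var fz)) (wk K)))
  -- (α.M) N : K = (α.((M) N)) : K = α.((M) N : K)
  colonApp (scal α M) N K = scal α (colonApp M N K)
  -- (M+N) L : K = ((M) L + (N) L) : K = ((M) L : K) + ((N) L : K)
  colonApp (plus M N) L K = plus (colonApp M L K) (colonApp N L K)
  colonApp (app M N) L K  =
    colonApp M N (lam (app (wk (tilde L))
                     (lam (app (app (var (fs fz)) (var fz)) (wk (wk K))))))

  _∶_ : {n : ℕ} → Term n → Term n → Term n
  M ∶ K = colon M K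

-- The colon M : K is where the CPS translation of M lands when run on K: (M̃) K →* M : K
-- by →a∪β, proved together with M : λg (Ñ) λh ((g) h) K →* (M) N : K. The rules A_l
-- and A_r are absorbed by the definition of the colon (both sides have literally the same
-- image), and a rule of L only rearranges the 0/α./+ structure, which the colon preserves,
-- so it is mapped to the same rule. For a β_v step, (λx M) B : K = (λf ((λx M̃) f) K) Ψ(B)
-- reduces in two β-steps to (M̃[x:=Ψ(B)]) K, and M̃[x:=Ψ(B)] is the translation of M[x:=B]
-- because B̃ = λf (f) Ψ(B); the first fact then finishes the step. Context closure holds
-- because the colon of a term in a ξ or ξ_lin context is a colon of the subterm with a
-- modified continuation.
module Submission where

open import Defs
open import Data.Nat using (ℕ; suc)
open import Data.Fin using (Fin) renaming (zero to fz; suc to fs)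
open import Data.Sum using (inj₁; inj₂)
open import Data.Product using (_×_; _,_; proj₁; proj₂)
open import Function using (_∘_; id)
open import Algebra.Bundles using (Ring)
open import Relation.Binary.PropositionalEquality
  using (_≡_; _≗_; refl; cong; cong₂; sym; trans)
open import Relation.Binary.Construct.Closure.ReflexiveTransitive using (ε; _◅_; _◅◅_; gmap)
open import Relation.Binary.Construct.Closure.ReflexiveTransitive.Properties
  using (module StarReasoning)

module CPS {c ℓ} (R : Ring c ℓ) where
  open Lang R

  ext-cong : ∀ {n m} {ρ ρ' : Fin n → Fin m} → ρ ≗ ρ' → ext ρ ≗ ext ρ'
  ext-cong e fz     = refl
  ext-cong e (fs x) = cong fs (e x)

  rename-cong : ∀ {n m} {ρ ρ' : Fin n → Fin m} → ρ ≗ ρ' → rename ρ ≗ rename ρ'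
  rename-cong e (var x)    = cong var (e x)
  rename-cong e (lam M)    = cong lam (rename-cong (ext-cong e) M)
  rename-cong e zer        = refl
  rename-cong e (app M N)  = cong₂ app (rename-cong e M) (rename-cong e N)
  rename-cong e (scal α M) = cong (scal α) (rename-cong e M)
  rename-cong e (plus M N) = cong₂ plus (rename-cong e M) (rename-cong e N)

  rename-∘ : ∀ {n m k} (ρ : Fin m → Fin k) (ρ' : Fin n → Fin m) →
             rename ρ ∘ rename ρ' ≗ rename (ρ ∘ ρ')
  rename-∘ ρ ρ' (var x)    = refl
  rename-∘ ρ ρ' (lam M)    =
    cong lam (trans (rename-∘ (ext ρ) (ext ρ') M) (rename-cong (λ { fz → refl ; (fs x) → refl }) M))
  rename-∘ ρ ρ' zer        = refl
  rename-∘ ρ ρ' (app M N)  = cong₂ app (rename-∘ ρ ρ' M) (rename-∘ ρ ρ' N)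
  rename-∘ ρ ρ' (scal α M) = cong (scal α) (rename-∘ ρ ρ' M)
  rename-∘ ρ ρ' (plus M N) = cong₂ plus (rename-∘ ρ ρ' M) (rename-∘ ρ ρ' N)

  rename-ext-wk : ∀ {n m} (ρ : Fin n → Fin m) (M : Term n) → rename (ext ρ) (wk M) ≡ wk (rename ρ M)
  rename-ext-wk ρ M = trans (rename-∘ (ext ρ) fs M) (sym (rename-∘ fs ρ M))

  exts-cong : ∀ {n m} {σ σ' : Fin n → Term m} → σ ≗ σ' → exts σ ≗ exts σ'
  exts-cong e fz     = refl
  exts-cong e (fs x) = cong wk (e x)

  subst-cong : ∀ {n m} {σ σ' : Fin n → Term m} → σ ≗ σ' → subst σ ≗ subst σ'
  subst-cong e (var x)    = e x
  subst-cong e (lam M)    = cong lam (subst-cong (exts-cong e) M)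
  subst-cong e zer        = refl
  subst-cong e (app M N)  = cong₂ app (subst-cong e M) (subst-cong e N)
  subst-cong e (scal α M) = cong (scal α) (subst-cong e M)
  subst-cong e (plus M N) = cong₂ plus (subst-cong e M) (subst-cong e N)

  subst-rename : ∀ {n m k} (σ : Fin m → Term k) (ρ : Fin n → Fin m) →
                 subst σ ∘ rename ρ ≗ subst (σ ∘ ρ)
  subst-rename σ ρ (var x)    = refl
  subst-rename σ ρ (lam M)    =
    cong lam (trans (subst-rename (exts σ) (ext ρ) M) (subst-cong (λ { fz → refl ; (fs x) → refl }) M))
  subst-rename σ ρ zer        = refl
  subst-rename σ ρ (app M N)  = cong₂ app (subst-rename σ ρ M) (subst-rename σ ρ N)
  subst-rename σ ρ (scal α M) = cong (scal α) (subst-rename σ ρ M)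
  subst-rename σ ρ (plus M N) = cong₂ plus (subst-rename σ ρ M) (subst-rename σ ρ N)

  rename-subst : ∀ {n m k} (ρ : Fin m → Fin k) (σ : Fin n → Term m) →
                 rename ρ ∘ subst σ ≗ subst (rename ρ ∘ σ)
  rename-subst ρ σ (var x)    = refl
  rename-subst ρ σ (lam M)    =
    cong lam (trans (rename-subst (ext ρ) (exts σ) M)
                    (subst-cong (λ { fz → refl ; (fs x) → rename-ext-wk ρ (σ x) }) M))
  rename-subst ρ σ zer        = refl
  rename-subst ρ σ (app M N)  = cong₂ app (rename-subst ρ σ M) (rename-subst ρ σ N)
  rename-subst ρ σ (scal α M) = cong (scal α) (rename-subst ρ σ M)
  rename-subst ρ σ (plus M N) = cong₂ plus (rename-subst ρ σ M) (rename-subst ρ σ N)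

  subst-var : ∀ {n} → subst {n} var ≗ id
  subst-var (var x)    = refl
  subst-var (lam M)    = cong lam (trans (subst-cong (λ { fz → refl ; (fs x) → refl }) M) (subst-var M))
  subst-var zer        = refl
  subst-var (app M N)  = cong₂ app (subst-var M) (subst-var N)
  subst-var (scal α M) = cong (scal α) (subst-var M)
  subst-var (plus M N) = cong₂ plus (subst-var M) (subst-var N)

  subst-exts-wk : ∀ {n m} (σ : Fin n → Term m) (M : Term n) → subst (exts σ) (wk M) ≡ wk (subst σ M)
  subst-exts-wk σ M = trans (subst-rename (exts σ) fs M) (sym (rename-subst fs σ M))

  wk-[] : ∀ {n} (W M : Term n) → wk M [ W ] ≡ M
  wk-[] W M = trans (subst-rename _ fs M) (subst-var M)

  wk²-[] : ∀ {n} (W M : Term n) → subst (exts (λ x → var x [ W ])) (wk (wk M)) ≡ wk M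
  wk²-[] W M = trans (subst-exts-wk _ (wk M)) (cong wk (wk-[] W M))

  ret : ∀ {n} → Term n → Term n
  ret V = lam (app (var fz) (wk V))

  tilde-base : ∀ {n} {B : Term n} (b : Base B) → tilde B ≡ ret (Ψ B (base b))
  tilde-base (var x) = refl
  tilde-base (lam M) = refl

  rename-ret : ∀ {n m} (ρ : Fin n → Fin m) (V : Term n) → rename ρ (ret V) ≡ ret (rename ρ V)
  rename-ret ρ V = cong (λ V' → lam (app (var fz) V')) (rename-ext-wk ρ V)

  subst-ret : ∀ {n m} (σ : Fin n → Term m) (V : Term n) → subst σ (ret V) ≡ ret (subst σ V)
  subst-ret σ V = cong (λ V' → lam (app (var fz) V')) (subst-exts-wk σ V)

  tilde-rename : ∀ {n m} (ρ : Fin n → Fin m) (M : Term n) → rename ρ (tilde M) ≡ tilde (rename ρ M)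
  rename-ext-wk-tilde : ∀ {n m} (ρ : Fin n → Fin m) (M : Term n) →
                        rename (ext ρ) (wk (tilde M)) ≡ wk (tilde (rename ρ M))

  tilde-rename ρ (var x)    = refl
  tilde-rename ρ (lam M)    =
    trans (rename-ret ρ (lam (tilde M))) (cong (λ M' → ret (lam M')) (tilde-rename (ext ρ) M))
  tilde-rename ρ zer        = refl
  tilde-rename ρ (app P Q)  =
    cong₂ (λ P' Q' → lam (app P' (lam (app Q' (lam (app (app (var (fs fz)) (var fz)) (var (fs (fs fz)))))))))
          (rename-ext-wk-tilde ρ P)
          (trans (rename-ext-wk (ext ρ) (wk (tilde Q))) (cong wk (rename-ext-wk-tilde ρ Q)))
  tilde-rename ρ (scal α P) =
    cong (λ P' → lam (app (scal α P') (var fz))) (rename-ext-wk-tilde ρ P)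
  tilde-rename ρ (plus P Q) =
    cong₂ (λ P' Q' → lam (app (plus P' Q') (var fz))) (rename-ext-wk-tilde ρ P) (rename-ext-wk-tilde ρ Q)

  rename-ext-wk-tilde ρ M = trans (rename-ext-wk ρ (tilde M)) (cong wk (tilde-rename ρ M))

  Translates : ∀ {n m} → (Fin n → Term m) → (Fin n → Term m) → Set c
  Translates σ τ = ∀ x → ret (σ x) ≡ tilde (τ x)

  translates-exts : ∀ {n m} {σ τ : Fin n → Term m} → Translates σ τ → Translates (exts σ) (exts τ)
  translates-exts t fz            = refl
  translates-exts {σ = σ} {τ} t (fs x) =
    trans (sym (rename-ret fs (σ x))) (trans (cong wk (t x)) (tilde-rename fs (τ x)))

  tilde-subst : ∀ {n m} {σ τ : Fin n → Term m} → Translates σ τ →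
                ∀ M → subst σ (tilde M) ≡ tilde (subst τ M)
  subst-exts-wk-tilde : ∀ {n m} {σ τ : Fin n → Term m} → Translates σ τ →
                        ∀ M → subst (exts σ) (wk (tilde M)) ≡ wk (tilde (subst τ M))

  tilde-subst t (var x)    = t x
  tilde-subst {σ = σ} t (lam M) =
    trans (subst-ret σ (lam (tilde M))) (cong (λ M' → ret (lam M')) (tilde-subst (translates-exts t) M))
  tilde-subst t zer        = refl
  tilde-subst {σ = σ} t (app P Q)  =
    cong₂ (λ P' Q' → lam (app P' (lam (app Q' (lam (app (app (var (fs fz)) (var fz)) (var (fs (fs fz)))))))))
          (subst-exts-wk-tilde t P)
          (trans (subst-exts-wk (exts σ) (wk (tilde Q))) (cong wk (subst-exts-wk-tilde t Q)))
  tilde-subst t (scal α P) =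
    cong (λ P' → lam (app (scal α P') (var fz))) (subst-exts-wk-tilde t P)
  tilde-subst t (plus P Q) =
    cong₂ (λ P' Q' → lam (app (plus P' Q') (var fz))) (subst-exts-wk-tilde t P) (subst-exts-wk-tilde t Q)

  subst-exts-wk-tilde {σ = σ} t M = trans (subst-exts-wk σ (tilde M)) (cong wk (tilde-subst t M))

  tilde-[] : ∀ {n} {B : Term n} (b : Base B) (M : Term (suc n)) → tilde M [ Ψ B (base b) ] ≡ tilde (M [ B ])
  tilde-[] {B = B} b = tilde-subst {σ = λ x → var x [ Ψ B (base b) ]} {τ = λ x → var x [ B ]}
                                  λ { fz → sym (tilde-base b) ; (fs x) → refl }

  infix 4 _⟶_ _⟶*_

  _⟶_ : ∀ {n} → Term n → Term n → Set c
  _⟶_ = _→a∪β_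

  _⟶*_ : ∀ {n} → Term n → Term n → Set c
  _⟶*_ = _→a∪β*_

  module ⟶*-Reasoning {n : ℕ} = StarReasoning (_⟶_ {n})
  open ⟶*-Reasoning

  β-step : ∀ {n} (M : Term (suc n)) (N : Term n) → app (lam M) N ⟶ M [ N ]
  β-step M N = inj₂ (base (beta M N))

  A-step : ∀ {n} {M N : Term n} → A M N → M ⟶ N
  A-step a = inj₁ (base (inj₁ a))

  LR-step : ∀ {n} {M N : Term n} → LR M N → M ⟶ N
  LR-step l = inj₁ (base (inj₂ l))

  ⟶-ctx : ∀ {n} {C : Term n → Term n} →
          (∀ {P : Rel} {M M'} → Ξ P M M' → Ξ P (C M) (C M')) → ∀ {M M'} → M ⟶ M' → C M ⟶ C M'
  ⟶-ctx ξ (inj₁ step) = inj₁ (ξ step)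
  ⟶-ctx ξ (inj₂ step) = inj₂ (ξ step)

  ⟶*-ctx : ∀ {n} {C : Term n → Term n} →
           (∀ {P : Rel} {M M'} → Ξ P M M' → Ξ P (C M) (C M')) → ∀ {M M'} → M ⟶* M' → C M ⟶* C M'
  ⟶*-ctx {C = C} ξ = gmap C (⟶-ctx ξ)

  ⟶*-plus : ∀ {n} {M M' N N' : Term n} → M ⟶* M' → N ⟶* N' → plus M N ⟶* plus M' N'
  ⟶*-plus {M' = M'} {N} M⟶*M' N⟶*N' = ⟶*-ctx (plusL N) M⟶*M' ◅◅ ⟶*-ctx (plusR M') N⟶*N'

  ⟶*-scal : ∀ {n} {M M' : Term n} α → M ⟶* M' → scal α M ⟶* scal α M'
  ⟶*-scal α = ⟶*-ctx (scal α)

  -- The continuations built by the colon: funCont W K = λf ((W) f) K and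
  -- argCont N K = λg (Ñ) λh ((g) h) K, so that (B) N : K = N : funCont Ψ(B) K and
  -- ((M) N) L : K = (M) N : argCont L K.
  funCont : ∀ {n} → Term n → Term n → Term n
  funCont W K = lam (app (app (wk W) (var fz)) (wk K))

  argCont : ∀ {n} → Term n → Term n → Term n
  argCont N K = lam (app (wk (tilde N)) (lam (app (app (var (fs fz)) (var fz)) (wk (wk K)))))

  colon-base : ∀ {n} {B : Term n} (b : Base B) (K : Term n) → B ∶ K ≡ app K (Ψ B (base b))
  colon-base (var x) K = refl
  colon-base (lam M) K = refl

  funCont-app : ∀ {n} (W K V : Term n) → app (funCont W K) V ⟶* app (app W V) K
  funCont-app W K V = begin
    app (funCont W K) V                   ⟶⟨ β-step _ V ⟩
    app (app (wk W [ V ]) V) (wk K [ V ]) ≡⟨ cong₂ (λ W' K' → app (app W' V) K') (wk-[] V W) (wk-[] V K) ⟩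
    app (app W V) K                       ∎

  tilde-app-⟶* : ∀ {n} (M K : Term n) → app (tilde M) K ⟶* M ∶ K
  colon-argCont-⟶* : ∀ {n} (M N K : Term n) → M ∶ argCont N K ⟶* colonApp M N K
  argCont-app-⟶* : ∀ {n} (N K W : Term n) → app (argCont N K) W ⟶* N ∶ funCont W K

  tilde-app-⟶* (var x) K    = β-step _ K ◅ ε
  tilde-app-⟶* zer K        = A-step (a₃ K) ◅ ε
  tilde-app-⟶* (lam M) K    = begin
    app (tilde (lam M)) K            ⟶⟨ β-step _ K ⟩
    app K (wk (lam (tilde M)) [ K ]) ≡⟨ cong (app K) (wk-[] K (lam (tilde M))) ⟩
    app K (lam (tilde M))            ∎
  tilde-app-⟶* (app P Q) K  = begin
    app (tilde (app P Q)) K     ⟶⟨ β-step _ K ⟩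
    _                           ≡⟨ cong₂ (λ P' Q' → app P' (lam (app Q' (lam (app (app (var (fs fz)) (var fz))
                                                                                 (wk (wk K)))))))
                                         (wk-[] K (tilde P)) (wk²-[] K (tilde Q)) ⟩
    app (tilde P) (argCont Q K) ⟶*⟨ tilde-app-⟶* P (argCont Q K) ⟩
    P ∶ argCont Q K             ⟶*⟨ colon-argCont-⟶* P Q K ⟩
    colonApp P Q K              ∎
  tilde-app-⟶* (scal α P) K = begin
    app (tilde (scal α P)) K    ⟶⟨ β-step _ K ⟩
    _                           ≡⟨ cong (λ P' → app (scal α P') K) (wk-[] K (tilde P)) ⟩
    app (scal α (tilde P)) K    ⟶⟨ A-step (a₂ α (tilde P) K) ⟩
    scal α (app (tilde P) K)    ⟶*⟨ ⟶*-scal α (tilde-app-⟶* P K) ⟩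
    scal α (P ∶ K)              ∎
  tilde-app-⟶* (plus P Q) K = begin
    app (tilde (plus P Q)) K                 ⟶⟨ β-step _ K ⟩
    _                                        ≡⟨ cong₂ (λ P' Q' → app (plus P' Q') K) (wk-[] K (tilde P)) (wk-[] K (tilde Q)) ⟩
    app (plus (tilde P) (tilde Q)) K         ⟶⟨ A-step (a₁ (tilde P) (tilde Q) K) ⟩
    plus (app (tilde P) K) (app (tilde Q) K) ⟶*⟨ ⟶*-plus (tilde-app-⟶* P K) (tilde-app-⟶* Q K) ⟩
    plus (P ∶ K) (Q ∶ K)                     ∎

  colon-argCont-⟶* zer N K        = ε
  colon-argCont-⟶* (var x) N K    = argCont-app-⟶* N K (var x)
  colon-argCont-⟶* (lam M) N K    = argCont-app-⟶* N K (lam (tilde M))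
  colon-argCont-⟶* (app P Q) N K  = ε
  colon-argCont-⟶* (scal α P) N K = ⟶*-scal α (colon-argCont-⟶* P N K)
  colon-argCont-⟶* (plus P Q) N K = ⟶*-plus (colon-argCont-⟶* P N K) (colon-argCont-⟶* Q N K)

  argCont-app-⟶* N K W = begin
    app (argCont N K) W             ⟶⟨ β-step _ W ⟩
    _                               ≡⟨ cong₂ (λ N' K' → app N' (lam (app (app (wk W) (var fz)) K')))
                                             (wk-[] W (tilde N)) (wk²-[] W K) ⟩
    app (tilde N) (funCont W K)     ⟶*⟨ tilde-app-⟶* N (funCont W K) ⟩
    N ∶ funCont W K                 ∎

  Simulated : ∀ {n} → Term n → Term n → Set c
  Simulated M M' = ∀ K → (M ∶ K ⟶* M' ∶ K) × (∀ N → colonApp M N K ⟶* colonApp M' N K)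

  AllSimulated : Rel → Set c
  AllSimulated P = ∀ {n} {M M' : Term n} → P M M' → Simulated M M'

  module _ {P : Rel} (simulated : AllSimulated P) where

    colon-⟶*        : ∀ {n} {M M' : Term n} → Ξlin P M M' → ∀ K → M ∶ K ⟶* M' ∶ K
    colonApp-⟶*     : ∀ {n} {M M' : Term n} → Ξlin P M M' → ∀ N K → colonApp M N K ⟶* colonApp M' N K
    colonApp-arg-⟶* : ∀ {n} {V M M' : Term n} → Value V → Ξlin P M M' →
                      ∀ K → colonApp V M K ⟶* colonApp V M' K

    colon-⟶* (base step) K    = proj₁ (simulated step K)
    colon-⟶* (appL N d) K     = colonApp-⟶* d N K
    colon-⟶* (plusL N d) K    = ⟶*-plus (colon-⟶* d K) ε
    colon-⟶* (plusR N d) K    = ⟶*-plus ε (colon-⟶* d K)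
    colon-⟶* (scal α d) K     = ⟶*-scal α (colon-⟶* d K)
    colon-⟶* (appR V v d) K   = colonApp-arg-⟶* v d K

    colonApp-⟶* (base step) N K  = proj₂ (simulated step K) N
    colonApp-⟶* (appL L d) N K   = colonApp-⟶* d L (argCont N K)
    colonApp-⟶* (plusL L d) N K  = ⟶*-plus (colonApp-⟶* d N K) ε
    colonApp-⟶* (plusR L d) N K  = ⟶*-plus ε (colonApp-⟶* d N K)
    colonApp-⟶* (scal α d) N K   = ⟶*-scal α (colonApp-⟶* d N K)
    colonApp-⟶* (appR V v d) N K = colonApp-arg-⟶* v d (argCont N K)

    colonApp-arg-⟶* zer d K            = ε
    colonApp-arg-⟶* (base (var x)) d K = colon-⟶* d _
    colonApp-arg-⟶* (base (lam M)) d K = colon-⟶* d _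
    colonApp-arg-⟶* (scal α v) d K     = ⟶*-scal α (colonApp-arg-⟶* v d K)
    colonApp-arg-⟶* (plus v w) d K     = ⟶*-plus (colonApp-arg-⟶* v d K) (colonApp-arg-⟶* w d K)

  LR-colon : ∀ {n} {M M' : Term n} → LR M M' → ∀ K → LR (M ∶ K) (M' ∶ K)
  LR-colon (asso (asso₁ M N L)) K = asso (asso₁ _ _ _)
  LR-colon (asso (asso₂ M N L)) K = asso (asso₂ _ _ _)
  LR-colon (com (com M N)) K      = com (com _ _)
  LR-colon (f (f₁ α β M)) K       = f (f₁ α β _)
  LR-colon (f (f₂ α M)) K         = f (f₂ α _)
  LR-colon (f (f₃ M)) K           = f (f₃ _)
  LR-colon (f (f₄ α β M)) K       = f (f₄ α β _)
  LR-colon (s (s₁ α M N)) K       = s (s₁ α _ _)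
  LR-colon (s (s₂ M)) K           = s (s₂ _)
  LR-colon (s (s₃ M)) K           = s (s₃ _)
  LR-colon (s (s₄ α)) K           = s (s₄ α)
  LR-colon (s (s₅ M)) K           = s (s₅ _)

  LR-colonApp : ∀ {n} {M M' : Term n} → LR M M' → ∀ N K → LR (colonApp M N K) (colonApp M' N K)
  LR-colonApp (asso (asso₁ M N L)) _ K = asso (asso₁ _ _ _)
  LR-colonApp (asso (asso₂ M N L)) _ K = asso (asso₂ _ _ _)
  LR-colonApp (com (com M N)) _ K      = com (com _ _)
  LR-colonApp (f (f₁ α β M)) _ K       = f (f₁ α β _)
  LR-colonApp (f (f₂ α M)) _ K         = f (f₂ α _)
  LR-colonApp (f (f₃ M)) _ K           = f (f₃ _)
  LR-colonApp (f (f₄ α β M)) _ K       = f (f₄ α β _)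
  LR-colonApp (s (s₁ α M N)) _ K       = s (s₁ α _ _)
  LR-colonApp (s (s₂ M)) _ K           = s (s₂ _)
  LR-colonApp (s (s₃ M)) _ K           = s (s₃ _)
  LR-colonApp (s (s₄ α)) _ K           = s (s₄ α)
  LR-colonApp (s (s₅ M)) _ K           = s (s₅ _)

  -- Both sides of an A_l or A_r rule have the same colon, by its defining equations.
  ℓ-simulated : AllSimulated ((Al ∪ Ar) ∪ LR)
  ℓ-simulated (inj₁ (inj₁ (al₁ M N V v))) K          = ε , λ _ → ε
  ℓ-simulated (inj₁ (inj₁ (al₂ α M V v))) K          = ε , λ _ → ε
  ℓ-simulated (inj₁ (inj₁ (al₃ V v))) K              = ε , λ _ → ε
  ℓ-simulated (inj₁ (inj₂ (ar₁ _ M N (var x)))) K    = ε , λ _ → ε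
  ℓ-simulated (inj₁ (inj₂ (ar₁ _ M N (lam P)))) K    = ε , λ _ → ε
  ℓ-simulated (inj₁ (inj₂ (ar₂ α _ M (var x)))) K    = ε , λ _ → ε
  ℓ-simulated (inj₁ (inj₂ (ar₂ α _ M (lam P)))) K    = ε , λ _ → ε
  ℓ-simulated (inj₁ (inj₂ (ar₃ _ (var x)))) K        = ε , λ _ → ε
  ℓ-simulated (inj₁ (inj₂ (ar₃ _ (lam P)))) K        = ε , λ _ → ε
  ℓ-simulated (inj₂ l) K = LR-step (LR-colon l K) ◅ ε , λ N → LR-step (LR-colonApp l N K) ◅ ε

  β-colon : ∀ {n} (M : Term (suc n)) {B : Term n} (b : Base B) (K : Term n) →
            app (lam M) B ∶ K ⟶* (M [ B ]) ∶ K
  β-colon M {B} b K = begin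
    app (lam M) B ∶ K                  ≡⟨ colon-base b (funCont (lam (tilde M)) K) ⟩
    app (funCont (lam (tilde M)) K) W  ⟶*⟨ funCont-app (lam (tilde M)) K W ⟩
    app (app (lam (tilde M)) W) K      ⟶⟨ ⟶-ctx (appL K) (β-step (tilde M) W) ⟩
    app (tilde M [ W ]) K              ≡⟨ cong (λ M' → app M' K) (tilde-[] b M) ⟩
    app (tilde (M [ B ])) K            ⟶*⟨ tilde-app-⟶* (M [ B ]) K ⟩
    (M [ B ]) ∶ K                      ∎
    where W = Ψ B (base b)

  βv-simulated : AllSimulated βv
  βv-simulated (beta M B b) K =
    β-colon M b K , λ N → β-colon M b (argCont N K) ◅◅ colon-argCont-⟶* (M [ B ]) N K

lemma6 : ∀ {c ℓ} (R : Ring c ℓ) → let open Lang R in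
         ∀ {n : ℕ} (M N : Term n) → M →ℓ∪β N →
         ∀ (K : Term n) → Base K → (M ∶ K) →a∪β* (N ∶ K)
lemma6 R M N (inj₁ ℓ-step)  K _ = colon-⟶* ℓ-simulated ℓ-step K  where open CPS R
lemma6 R M N (inj₂ βv-step) K _ = colon-⟶* βv-simulated βv-step K where open CPS R
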